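{- Let $C\subseteq\mathbb{Z}_2^n$ be an $11$-cap of dimension $7$ with a basis $B$ of type $7\text{ - }5\text{ - }5$. Then $B$ has extended type $7\text{ - }5\text{ - }5\text{ - }(4,4,3)$; that is, if $D=C\setminus B=\{x_1,x_2,x_3\}$ with $|B_{x_1}|=7$ and $|B_{x_2}|=|B_{x_3}|=5$, then $|B_{x_1}\cap B_{x_2}|=|B_{x_1}\cap B_{x_3}|=4$ and $|B_{x_2}\cap B_{x_3}|=3$.
   Context: Work in $\mathbb{Z}_2^n$. An affine combination of a set is a sum of an odd number of its distinct elements; $\operatorname{aff}(S)$ is the set of all affine combinations of elements of $S$, and the dimension of $S$ is the dimension of the affine flat $\operatorname{aff}(S)$. A basis for $S$ is a subset $B\subseteq S$ that is affinely independent (no element is an affine combination of the others) with $\operatorname{aff}(B)=\operatorname{aff}(S)$; its dependent set is $D=S\setminus B$. For $x\in D$, $B_x$ is the unique subset of $B$ whose elements sum to $x$. A quad is a set of four distinct elements summing to $\mathbf{0}$; a cap is a quad-free subset; a $k$-cap is a cap with $k$ elements. The type of $B$ is the list of the numbers $|B_x|$, $x\in D$, in nonincreasing order, separated by hyphens. -}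

module Defs where

open import Data.Bool using (Bool; true; false; _xor_)
open import Data.Bool.Properties using () renaming (_≟_ to _≟ᵇ_)
open import Data.Nat using (ℕ; suc; _*_)
open import Data.Vec using (Vec; zipWith; replicate)
import Data.Vec.Properties as VecP
open import Data.List using (List; []; _∷_; length; foldr; filter)
open import Data.List.Membership.Propositional using (_∈_; _∉_; _─_)
open import Data.List.Membership.DecPropositional using () renaming (_∈?_ to ∈?-gen)
open import Data.List.Relation.Unary.Unique.Propositional using (Unique)
open import Data.List.Relation.Binary.Sublist.Propositional using (_⊆_)
open import Data.Product using (Σ; ∃; _×_)
open import Relation.Binary.PropositionalEquality using (_≡_; _≢_)
open import Relation.Binary.Definitions using (DecidableEquality)
open import Relation.Nullary using (¬_)
open import Function.Bundles using (_⇔_)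

Pt : ℕ → Set
Pt n = Vec Bool n

_⊕_ : ∀ {n} → Pt n → Pt n → Pt n
_⊕_ = zipWith _xor_

𝟎 : ∀ {n} → Pt n
𝟎 = replicate _ false

_≟ₚ_ : ∀ {n} → DecidableEquality (Pt n)
_≟ₚ_ = VecP.≡-dec _≟ᵇ_

sumₚ : ∀ {n} → List (Pt n) → Pt n
sumₚ = foldr _⊕_ 𝟎

Odd : ℕ → Set
Odd k = ∃ λ m → k ≡ suc (2 * m)

-- Finite sets of points are lists without repetitions (Unique); a subset of
-- such a set S is a sublist T ⊆ S (its elements are automatically distinct).

-- x is an affine combination of S: the sum of an odd number of distinct
-- elements of S.   (x ∈ aff S)
InAff : ∀ {n} → List (Pt n) → Pt n → Set
InAff S x = Σ (List _) λ T → T ⊆ S × Odd (length T) × sumₚ T ≡ x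

SameAff : ∀ {n} → List (Pt n) → List (Pt n) → Set
SameAff S S' = ∀ x → InAff S x ⇔ InAff S' x

AffIndep : ∀ {n} → List (Pt n) → Set
AffIndep S = Unique S × (∀ {y} (p : y ∈ S) → ¬ InAff (S ─ p) y)

HasDim : ∀ {n} → List (Pt n) → ℕ → Set
HasDim S d = Σ (List _) λ B → AffIndep B × SameAff B S × length B ≡ suc d

IsBasis : ∀ {n} → List (Pt n) → List (Pt n) → Set
IsBasis B S = (∀ {y} → y ∈ B → y ∈ S) × AffIndep B × SameAff B S

IsCap : ∀ {n} → List (Pt n) → Set
IsCap S = ∀ T → T ⊆ S → length T ≡ 4 → sumₚ T ≢ 𝟎

IsKCap : ∀ {n} → ℕ → List (Pt n) → Set
IsKCap k S = Unique S × length S ≡ k × IsCap S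

-- B_x: a subset of B whose elements sum to x
IsRep : ∀ {n} → List (Pt n) → Pt n → List (Pt n) → Set
IsRep B x T = T ⊆ B × sumₚ T ≡ x

∣_∩_∣ : ∀ {n} → List (Pt n) → List (Pt n) → ℕ
∣ T ∩ U ∣ = length (filter (λ y → ∈?-gen _≟ₚ_ y U) T)

-- Write B_{x₁}, B_{x₂}, B_{x₃} as characteristic vectors t₁, t₂, t₃ of subsets of B.
-- The basis and the three dependent points are distinct points of the 11-cap, so
-- |B| ≤ 8.  Summing over B is linear in the characteristic vector, so the cap would
-- contain a quad if some tᵢ ⊕ tⱼ had two elements, if t₁ ⊕ t₂ ⊕ t₃ had one, or if
-- t₂ = t₃.  For subsets of sizes 7, 5, 5 of an at most 8-element set these
-- constraints leave only the intersection sizes 4, 4, 3; this is a statement about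
-- the sizes of the eight Venn regions, checked exhaustively.

module Submission where

open import Defs
open import Algebra.Bundles using (AbelianGroup)
open import Algebra.Structures using (IsAbelianGroup)
import Algebra.Properties.AbelianGroup as AbelianGroupProperties
import Algebra.Properties.CommutativeSemigroup as CommutativeSemigroupProperties
open import Data.Bool using (Bool; true; false; _xor_; _∧_; if_then_else_)
open import Data.Bool.Properties using (xor-assoc; xor-comm; xor-identityˡ; xor-identityʳ; xor-same)
open import Data.Fin using (Fin; zero; suc; #_)
open import Data.Fin.Subset using (Subset; _∩_; ⊥) renaming (∣_∣ to ∣_∣ˢ)
open import Data.List using (List; []; _∷_; _++_; length; concatMap; map; upTo)
open import Data.List.Membership.Propositional using (_∈_; _∉_)
open import Data.List.Membership.DecPropositional using () renaming (_∈?_ to ∈?-gen)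
open import Data.List.Membership.Propositional.Properties using (∈-++⁻; ∈-map⁺; ∈-concatMap⁺; ∈-upTo⁺)
open import Data.List.Properties using (length-++; filter-accept; filter-reject)
open import Data.List.Relation.Binary.Permutation.Propositional
  using (_↭_; ↭-refl; ↭-prep; ↭-swap; ↭-trans; ↭⇒↭ₛ)
open import Data.List.Relation.Binary.Permutation.Propositional.Properties using (↭-length; ∈-resp-↭)
open import Data.List.Relation.Binary.Permutation.Setoid.Properties using (foldr-commMonoid)
open import Data.List.Relation.Binary.Sublist.Propositional using (_⊆_; []; _∷_; _∷ʳ_; minimum; ⊆-refl)
open import Data.List.Relation.Binary.Sublist.Propositional.Properties using (All-resp-⊆; Any-resp-⊆)
open import Data.List.Relation.Binary.Sublist.Heterogeneous.Properties using (length-mono-≤)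
open import Data.List.Relation.Unary.All as All using (All; all?; []; _∷_)
open import Data.List.Relation.Unary.AllPairs using ([]; _∷_)
open import Data.List.Relation.Unary.Any as Any using (here; there)
open import Data.List.Relation.Unary.Unique.Propositional using (Unique)
open import Data.List.Relation.Unary.Unique.Propositional.Properties using (++⁺)
open import Data.Nat using (ℕ; zero; suc; _+_; _∸_; _≤_; s≤s; s≤s⁻¹)
open import Data.Nat.Properties using (_≟_; +-suc; +-commutativeSemigroup; m+n≤o⇒n≤o; m+n≤o⇒m≤o∸n)
open import Data.Product using (∃; _×_; _,_; proj₁; proj₂)
open import Data.Sum using (_⊎_; inj₁; inj₂)
open import Data.Vec using (Vec; []; _∷_; replicate; updateAt; lookup; sum; zipWith)
open import Data.Vec.Properties
  using (zipWith-assoc; zipWith-comm; zipWith-identityˡ; zipWith-identityʳ; zipWith-inverseˡ; map-id)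
open import Function using (id; _∘_)
open import Function.Bundles using (_⇔_; Equivalence)
open import Level using (0ℓ)
open import Relation.Binary.PropositionalEquality
open import Relation.Nullary using (contradiction; Dec; yes; no; ¬?; _×-dec_; _→-dec_)
open import Relation.Nullary.Decidable using (toWitness)

private
  variable
    A : Set
    k m n : ℕ
    x : A
    xs ys : List A

⊕-isAbelianGroup : IsAbelianGroup _≡_ (_⊕_ {n}) 𝟎 id
⊕-isAbelianGroup = record
  { isGroup = record
    { isMonoid = record
      { isSemigroup = record
        { isMagma = record { isEquivalence = isEquivalence ; ∙-cong = cong₂ _⊕_ }
        ; assoc = zipWith-assoc xor-assoc
        }
      ; identity = zipWith-identityˡ xor-identityˡ , zipWith-identityʳ xor-identityʳ
      }
    ; inverse = x⊕x≡𝟎 , x⊕x≡𝟎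
    ; ⁻¹-cong = id
    }
  ; comm = zipWith-comm xor-comm
  }
  where
  x⊕x≡𝟎 : ∀ x → x ⊕ x ≡ 𝟎
  x⊕x≡𝟎 x = trans (cong (_⊕ x) (sym (map-id x))) (zipWith-inverseˡ xor-same x)

⊕-abelianGroup : ℕ → AbelianGroup 0ℓ 0ℓ
⊕-abelianGroup n = record { isAbelianGroup = ⊕-isAbelianGroup {n} }

private
  module ⊕ {n} = AbelianGroup (⊕-abelianGroup n)
  module ⊕-Group {n} = AbelianGroupProperties (⊕-abelianGroup n)
  module ⊕-Semigroup {n} = CommutativeSemigroupProperties (⊕.commutativeSemigroup {n})
  module +-Semigroup = CommutativeSemigroupProperties +-commutativeSemigroup

x⊕y≡𝟎⇒x≡y : {x y : Pt n} → x ⊕ y ≡ 𝟎 → x ≡ y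
x⊕y≡𝟎⇒x≡y = ⊕-Group.inverseˡ-unique _ _

sumₚ-++ : (ps qs : List (Pt n)) → sumₚ (ps ++ qs) ≡ sumₚ ps ⊕ sumₚ qs
sumₚ-++ [] qs = sym (⊕.identityˡ _)
sumₚ-++ (p ∷ ps) qs = trans (cong (p ⊕_) (sumₚ-++ ps qs)) (sym (⊕.assoc p _ _))

sumₚ-↭ : {ps qs : List (Pt n)} → ps ↭ qs → sumₚ ps ≡ sumₚ qs
sumₚ-↭ ps↭qs = foldr-commMonoid (setoid _) ⊕.isCommutativeMonoid (↭⇒↭ₛ ps↭qs)

Unique-resp-⊇ : xs ⊆ ys → Unique ys → Unique xs
Unique-resp-⊇ [] [] = []
Unique-resp-⊇ (y ∷ʳ xs⊆ys) (_ ∷ ys!) = Unique-resp-⊇ xs⊆ys ys!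
Unique-resp-⊇ (refl ∷ xs⊆ys) (y≢ys ∷ ys!) = All-resp-⊆ xs⊆ys y≢ys ∷ Unique-resp-⊇ xs⊆ys ys!

insert-sublist : xs ⊆ ys → x ∈ ys → x ∉ xs → ∃ λ zs → zs ⊆ ys × zs ↭ x ∷ xs
insert-sublist (y ∷ʳ xs⊆ys) (here refl) _ = _ , refl ∷ xs⊆ys , ↭-refl
insert-sublist (y ∷ʳ xs⊆ys) (there x∈ys) x∉xs with insert-sublist xs⊆ys x∈ys x∉xs
... | zs , zs⊆ys , zs↭ = zs , y ∷ʳ zs⊆ys , zs↭
insert-sublist (refl ∷ xs⊆ys) (here refl) x∉xs = contradiction (here refl) x∉xs
insert-sublist {x = x} (_∷_ {x = y} refl xs⊆ys) (there x∈ys) x∉xs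
  with insert-sublist xs⊆ys x∈ys (x∉xs ∘ there)
... | zs , zs⊆ys , zs↭ = y ∷ zs , refl ∷ zs⊆ys , ↭-trans (↭-prep y zs↭) (↭-swap y x ↭-refl)

unique⇒sublist-↭ : Unique xs → (∀ {x} → x ∈ xs → x ∈ ys) → ∃ λ zs → zs ⊆ ys × zs ↭ xs
unique⇒sublist-↭ [] _ = [] , minimum _ , ↭-refl
unique⇒sublist-↭ {xs = x ∷ xs} (x≢xs ∷ xs!) xs⊆ys with unique⇒sublist-↭ xs! (xs⊆ys ∘ there)
... | zs , zs⊆ys , zs↭xs
  with insert-sublist zs⊆ys (xs⊆ys (here refl)) (λ x∈zs → All.lookup x≢xs (∈-resp-↭ zs↭xs x∈zs) refl)
... | ws , ws⊆ys , ws↭ = ws , ws⊆ys , ↭-trans ws↭ (↭-prep x zs↭xs)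

unique⇒length≤ : Unique xs → (∀ {x} → x ∈ xs → x ∈ ys) → length xs ≤ length ys
unique⇒length≤ xs! xs⊆ys with unique⇒sublist-↭ xs! xs⊆ys
... | zs , zs⊆ys , zs↭xs = subst (_≤ _) (↭-length zs↭xs) (length-mono-≤ zs⊆ys)

-- Sublists as characteristic vectors

select : (xs : List A) → Subset (length xs) → List A
select [] [] = []
select (x ∷ xs) (true ∷ p) = x ∷ select xs p
select (x ∷ xs) (false ∷ p) = select xs p

select-⊆ : (xs : List A) (p : Subset (length xs)) → select xs p ⊆ xs
select-⊆ [] [] = []
select-⊆ (x ∷ xs) (true ∷ p) = refl ∷ select-⊆ xs p
select-⊆ (x ∷ xs) (false ∷ p) = x ∷ʳ select-⊆ xs p

length-select : (xs : List A) (p : Subset (length xs)) → length (select xs p) ≡ ∣ p ∣ˢ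
length-select [] [] = refl
length-select (x ∷ xs) (true ∷ p) = cong suc (length-select xs p)
length-select (x ∷ xs) (false ∷ p) = length-select xs p

∣p∣≡0⇒p≡⊥ : {p : Subset k} → ∣ p ∣ˢ ≡ 0 → p ≡ ⊥
∣p∣≡0⇒p≡⊥ {p = []} _ = refl
∣p∣≡0⇒p≡⊥ {p = false ∷ p} ∣p∣≡0 = cong (false ∷_) (∣p∣≡0⇒p≡⊥ ∣p∣≡0)

⊆⇒select : ys ⊆ xs → ∃ λ p → select xs p ≡ ys
⊆⇒select [] = [] , refl
⊆⇒select (x ∷ʳ ys⊆xs) with ⊆⇒select ys⊆xs
... | p , refl = false ∷ p , refl
⊆⇒select (refl ∷ ys⊆xs) with ⊆⇒select ys⊆xs
... | p , refl = true ∷ p , refl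

∉-select : All (x ≢_) xs → (p : Subset (length xs)) → x ∉ select xs p
∉-select x≢xs p x∈select = All.lookup x≢xs (Any-resp-⊆ (select-⊆ _ p) x∈select) refl

sumₚ-select-⊕ : (xs : List (Pt n)) (p q : Subset (length xs)) →
  sumₚ (select xs (p ⊕ q)) ≡ sumₚ (select xs p) ⊕ sumₚ (select xs q)
sumₚ-select-⊕ [] [] [] = sym (⊕.identityˡ 𝟎)
sumₚ-select-⊕ (x ∷ xs) (true ∷ p) (true ∷ q) = begin
  sumₚ (select xs (p ⊕ q))                          ≡⟨ sumₚ-select-⊕ xs p q ⟩
  sumₚ (select xs p) ⊕ sumₚ (select xs q)           ≡⟨ ⊕.identityˡ _ ⟨
  𝟎 ⊕ (sumₚ (select xs p) ⊕ sumₚ (select xs q))     ≡⟨ cong (_⊕ _) (⊕.inverseˡ x) ⟨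
  (x ⊕ x) ⊕ (sumₚ (select xs p) ⊕ sumₚ (select xs q)) ≡⟨ ⊕-Semigroup.interchange x x _ _ ⟩
  (x ⊕ sumₚ (select xs p)) ⊕ (x ⊕ sumₚ (select xs q)) ∎
  where open ≡-Reasoning
sumₚ-select-⊕ (x ∷ xs) (true ∷ p) (false ∷ q) =
  trans (cong (x ⊕_) (sumₚ-select-⊕ xs p q)) (sym (⊕.assoc x _ _))
sumₚ-select-⊕ (x ∷ xs) (false ∷ p) (true ∷ q) =
  trans (cong (x ⊕_) (sumₚ-select-⊕ xs p q)) (⊕-Semigroup.x∙yz≈y∙xz x _ _)
sumₚ-select-⊕ (x ∷ xs) (false ∷ p) (false ∷ q) = sumₚ-select-⊕ xs p q

∣p⊕q∣≢0 : (xs : List (Pt n)) {p q : Subset (length xs)} {x y : Pt n} → x ≢ y →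
  sumₚ (select xs p) ≡ x → sumₚ (select xs q) ≡ y → ∣ p ⊕ q ∣ˢ ≢ 0
∣p⊕q∣≢0 xs x≢y σp σq ∣p⊕q∣≡0 =
  x≢y (trans (sym σp) (trans (cong (sumₚ ∘ select xs) (x⊕y≡𝟎⇒x≡y (∣p∣≡0⇒p≡⊥ ∣p⊕q∣≡0))) σq))

∣∷∩∣-∈ : (T U : List (Pt n)) {x : Pt n} → x ∈ U → ∣ x ∷ T ∩ U ∣ ≡ suc ∣ T ∩ U ∣
∣∷∩∣-∈ T U x∈U = cong length (filter-accept (λ y → ∈?-gen _≟ₚ_ y U) x∈U)

∣∷∩∣-∉ : (T U : List (Pt n)) {x : Pt n} → x ∉ U → ∣ x ∷ T ∩ U ∣ ≡ ∣ T ∩ U ∣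
∣∷∩∣-∉ T U x∉U = cong length (filter-reject (λ y → ∈?-gen _≟ₚ_ y U) x∉U)

∣∩∷∣-∉ : (T U : List (Pt n)) {x : Pt n} → x ∉ T → ∣ T ∩ x ∷ U ∣ ≡ ∣ T ∩ U ∣
∣∩∷∣-∉ [] U x∉T = refl
∣∩∷∣-∉ (z ∷ T) U {x} x∉z∷T = by-cases (∈?-gen _≟ₚ_ z U)
  where
  open ≡-Reasoning
  IH : ∣ T ∩ x ∷ U ∣ ≡ ∣ T ∩ U ∣
  IH = ∣∩∷∣-∉ T U (x∉z∷T ∘ there)
  by-cases : Dec (z ∈ U) → ∣ z ∷ T ∩ x ∷ U ∣ ≡ ∣ z ∷ T ∩ U ∣
  by-cases (yes z∈U) = begin
    ∣ z ∷ T ∩ x ∷ U ∣ ≡⟨ ∣∷∩∣-∈ T (x ∷ U) (there z∈U) ⟩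
    suc ∣ T ∩ x ∷ U ∣ ≡⟨ cong suc IH ⟩
    suc ∣ T ∩ U ∣     ≡⟨ ∣∷∩∣-∈ T U z∈U ⟨
    ∣ z ∷ T ∩ U ∣     ∎
  by-cases (no z∉U) = begin
    ∣ z ∷ T ∩ x ∷ U ∣ ≡⟨ ∣∷∩∣-∉ T (x ∷ U) z∉x∷U ⟩
    ∣ T ∩ x ∷ U ∣     ≡⟨ IH ⟩
    ∣ T ∩ U ∣         ≡⟨ ∣∷∩∣-∉ T U z∉U ⟨
    ∣ z ∷ T ∩ U ∣     ∎
    where
    z∉x∷U : z ∉ x ∷ U
    z∉x∷U (here z≡x) = x∉z∷T (here (sym z≡x))
    z∉x∷U (there z∈U) = z∉U z∈U

∣select∩select∣ : {xs : List (Pt n)} → Unique xs → (p q : Subset (length xs)) →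
  ∣ select xs p ∩ select xs q ∣ ≡ ∣ p ∩ q ∣ˢ
∣select∩select∣ {xs = []} [] [] [] = refl
∣select∩select∣ {xs = x ∷ xs} (x≢xs ∷ xs!) (true ∷ p) (true ∷ q) = begin
  ∣ x ∷ select xs p ∩ x ∷ select xs q ∣ ≡⟨ ∣∷∩∣-∈ (select xs p) (x ∷ select xs q) (here refl) ⟩
  suc ∣ select xs p ∩ x ∷ select xs q ∣ ≡⟨ cong suc (∣∩∷∣-∉ (select xs p) (select xs q) (∉-select x≢xs p)) ⟩
  suc ∣ select xs p ∩ select xs q ∣     ≡⟨ cong suc (∣select∩select∣ xs! p q) ⟩
  suc ∣ p ∩ q ∣ˢ                        ∎
  where open ≡-Reasoning
∣select∩select∣ {xs = x ∷ xs} (x≢xs ∷ xs!) (true ∷ p) (false ∷ q) =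
  trans (∣∷∩∣-∉ (select xs p) (select xs q) (∉-select x≢xs q)) (∣select∩select∣ xs! p q)
∣select∩select∣ {xs = x ∷ xs} (x≢xs ∷ xs!) (false ∷ p) (true ∷ q) =
  trans (∣∩∷∣-∉ (select xs p) (select xs q) (∉-select x≢xs p)) (∣select∩select∣ xs! p q)
∣select∩select∣ {xs = x ∷ xs} (x≢xs ∷ xs!) (false ∷ p) (false ∷ q) = ∣select∩select∣ xs! p q

module _ {C B X W : List (Pt n)} (B⊆C : ∀ {y} → y ∈ B → y ∈ C)
         (X⊆C∖B : ∀ {x} → x ∈ X → x ∈ C × x ∉ B) (W⊆B : ∀ {y} → y ∈ W → y ∈ B) where

  ++-unique : Unique X → Unique W → Unique (X ++ W)
  ++-unique X! W! = ++⁺ X! W! λ (y∈X , y∈W) → proj₂ (X⊆C∖B y∈X) (W⊆B y∈W)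

  ++-⊆ : ∀ {y} → y ∈ X ++ W → y ∈ C
  ++-⊆ y∈X++W with ∈-++⁻ X y∈X++W
  ... | inj₁ y∈X = proj₁ (X⊆C∖B y∈X)
  ... | inj₂ y∈W = B⊆C (W⊆B y∈W)

length-++-basis≤ : {C B X : List (Pt n)} → (∀ {y} → y ∈ B → y ∈ C) → Unique B →
  Unique X → (∀ {x} → x ∈ X → x ∈ C × x ∉ B) → length (X ++ B) ≤ length C
length-++-basis≤ B⊆C B! X! X⊆C∖B = unique⇒length≤ (++-unique B⊆C X⊆C∖B id X! B!) (++-⊆ B⊆C X⊆C∖B id)

cap⇒sumₚ≢𝟎 : {C L : List (Pt n)} → IsCap C → Unique L → (∀ {x} → x ∈ L → x ∈ C) →
  length L ≡ 4 → sumₚ L ≢ 𝟎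
cap⇒sumₚ≢𝟎 cap L! L⊆C |L|≡4 ΣL≡𝟎 with unique⇒sublist-↭ L! L⊆C
... | T , T⊆C , T↭L = cap T T⊆C (trans (↭-length T↭L) |L|≡4) (trans (sumₚ-↭ T↭L) ΣL≡𝟎)

module CapWithBasis {C B D : List (Pt n)} (cap : IsCap C) (B⊆C : ∀ {y} → y ∈ B → y ∈ C) (B! : Unique B)
                    (D! : Unique D) (D⊆C∖B : ∀ {x} → x ∈ D → x ∈ C × x ∉ B) where

  -- X together with the selected points of B would be a quad.
  sumₚ-select≢sumₚ : {X : List (Pt n)} → X ⊆ D →
    (w : Subset (length B)) → length X + ∣ w ∣ˢ ≡ 4 → sumₚ (select B w) ≢ sumₚ X
  sumₚ-select≢sumₚ {X} X⊆D w |X|+|w|≡4 ΣW≡ΣX =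
    cap⇒sumₚ≢𝟎 cap (++-unique B⊆C X⊆C∖B W⊆B (Unique-resp-⊇ X⊆D D!) (Unique-resp-⊇ (select-⊆ B w) B!))
      (++-⊆ B⊆C X⊆C∖B W⊆B) |X++W|≡4 ΣX++W≡𝟎
    where
    W = select B w
    X⊆C∖B : ∀ {x} → x ∈ X → x ∈ C × x ∉ B
    X⊆C∖B = D⊆C∖B ∘ Any-resp-⊆ X⊆D
    W⊆B : ∀ {y} → y ∈ W → y ∈ B
    W⊆B = Any-resp-⊆ (select-⊆ B w)
    |X++W|≡4 : length (X ++ W) ≡ 4
    |X++W|≡4 = trans (length-++ X) (trans (cong (length X +_) (length-select B w)) |X|+|w|≡4)
    ΣX++W≡𝟎 : sumₚ (X ++ W) ≡ 𝟎
    ΣX++W≡𝟎 = trans (sumₚ-++ X W) (trans (cong (sumₚ X ⊕_) ΣW≡ΣX) (⊕.inverseˡ (sumₚ X)))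

  σ : Subset (length B) → Pt n
  σ p = sumₚ (select B p)

  private
    σ-pair : ∀ {p q y z} → σ p ≡ y → σ q ≡ z → σ (p ⊕ q) ≡ sumₚ (y ∷ z ∷ [])
    σ-pair σp σq = trans (sumₚ-select-⊕ B _ _) (cong₂ _⊕_ σp (trans σq (sym (⊕.identityʳ _))))

  ∣p⊕q∣≢2 : ∀ {p q y z} → y ∷ z ∷ [] ⊆ D → σ p ≡ y → σ q ≡ z → ∣ p ⊕ q ∣ˢ ≢ 2
  ∣p⊕q∣≢2 yz⊆D σp σq ∣p⊕q∣≡2 = sumₚ-select≢sumₚ yz⊆D _ (cong (2 +_) ∣p⊕q∣≡2) (σ-pair σp σq)

  ∣p⊕q⊕r∣≢1 : ∀ {p q r x y z} → x ∷ y ∷ z ∷ [] ⊆ D → σ p ≡ x → σ q ≡ y → σ r ≡ z →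
    ∣ p ⊕ (q ⊕ r) ∣ˢ ≢ 1
  ∣p⊕q⊕r∣≢1 xyz⊆D σp σq σr ∣p⊕q⊕r∣≡1 =
    sumₚ-select≢sumₚ xyz⊆D _ (cong (3 +_) ∣p⊕q⊕r∣≡1)
      (trans (sumₚ-select-⊕ B _ _) (cong₂ _⊕_ σp (σ-pair σq σr)))

-- Venn diagrams of three sets

infixr 6 _⊕ᶜ_
infixr 7 _∩ᶜ_

data Combination : Set where
  𝐚 𝐛 𝐜     : Combination
  _⊕ᶜ_ _∩ᶜ_ : Combination → Combination → Combination

⟦_⟧ᵇ : Combination → Bool → Bool → Bool → Bool
⟦ 𝐚 ⟧ᵇ x y z = x
⟦ 𝐛 ⟧ᵇ x y z = y
⟦ 𝐜 ⟧ᵇ x y z = z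
⟦ e ⊕ᶜ f ⟧ᵇ x y z = ⟦ e ⟧ᵇ x y z xor ⟦ f ⟧ᵇ x y z
⟦ e ∩ᶜ f ⟧ᵇ x y z = ⟦ e ⟧ᵇ x y z ∧ ⟦ f ⟧ᵇ x y z

⟦_⟧ : Combination → Subset k → Subset k → Subset k → Subset k
⟦ 𝐚 ⟧ a b c = a
⟦ 𝐛 ⟧ a b c = b
⟦ 𝐜 ⟧ a b c = c
⟦ e ⊕ᶜ f ⟧ a b c = ⟦ e ⟧ a b c ⊕ ⟦ f ⟧ a b c
⟦ e ∩ᶜ f ⟧ a b c = ⟦ e ⟧ a b c ∩ ⟦ f ⟧ a b c

⟦⟧-[] : ∀ e → ⟦ e ⟧ [] [] [] ≡ []
⟦⟧-[] 𝐚 = refl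
⟦⟧-[] 𝐛 = refl
⟦⟧-[] 𝐜 = refl
⟦⟧-[] (e ⊕ᶜ f) = cong₂ _⊕_ (⟦⟧-[] e) (⟦⟧-[] f)
⟦⟧-[] (e ∩ᶜ f) = cong₂ _∩_ (⟦⟧-[] e) (⟦⟧-[] f)

⟦⟧-∷ : ∀ e {x y z} {a b c : Subset k} →
  ⟦ e ⟧ (x ∷ a) (y ∷ b) (z ∷ c) ≡ ⟦ e ⟧ᵇ x y z ∷ ⟦ e ⟧ a b c
⟦⟧-∷ 𝐚 = refl
⟦⟧-∷ 𝐛 = refl
⟦⟧-∷ 𝐜 = refl
⟦⟧-∷ (e ⊕ᶜ f) = cong₂ _⊕_ (⟦⟧-∷ e) (⟦⟧-∷ f)
⟦⟧-∷ (e ∩ᶜ f) = cong₂ _∩_ (⟦⟧-∷ e) (⟦⟧-∷ f)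

region : Bool → Bool → Bool → Fin 8
region true  true  true  = # 0
region true  true  false = # 1
region true  false true  = # 2
region true  false false = # 3
region false true  true  = # 4
region false true  false = # 5
region false false true  = # 6
region false false false = # 7

truthTable : Combination → Subset 8
truthTable e =
  ⟦ e ⟧ᵇ true  true  true ∷ ⟦ e ⟧ᵇ true  true  false ∷ ⟦ e ⟧ᵇ true  false true ∷ ⟦ e ⟧ᵇ true  false false ∷
  ⟦ e ⟧ᵇ false true  true ∷ ⟦ e ⟧ᵇ false true  false ∷ ⟦ e ⟧ᵇ false false true ∷ ⟦ e ⟧ᵇ false false false ∷ []

lookup-truthTable : ∀ e x y z → lookup (truthTable e) (region x y z) ≡ ⟦ e ⟧ᵇ x y z
lookup-truthTable e true  true  true  = refl
lookup-truthTable e true  true  false = refl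
lookup-truthTable e true  false true  = refl
lookup-truthTable e true  false false = refl
lookup-truthTable e false true  true  = refl
lookup-truthTable e false true  false = refl
lookup-truthTable e false false true  = refl
lookup-truthTable e false false false = refl

regionSizes : Subset k → Subset k → Subset k → Vec ℕ 8
regionSizes [] [] [] = replicate 8 0
regionSizes (x ∷ a) (y ∷ b) (z ∷ c) = updateAt (regionSizes a b c) (region x y z) suc

weight : Bool → ℕ → ℕ
weight b n = if b then n else 0

measure : Subset m → Vec ℕ m → ℕ
measure p r = sum (zipWith weight p r)

measure-replicate : (p : Subset m) → measure p (replicate m 0) ≡ 0
measure-replicate [] = refl
measure-replicate (true ∷ p) = measure-replicate p
measure-replicate (false ∷ p) = measure-replicate p

measure-updateAt : (p : Subset m) (r : Vec ℕ m) (i : Fin m) →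
  measure p (updateAt r i suc) ≡ weight (lookup p i) 1 + measure p r
measure-updateAt (true ∷ p) (n ∷ r) zero = refl
measure-updateAt (false ∷ p) (n ∷ r) zero = refl
measure-updateAt (b ∷ p) (n ∷ r) (suc i) =
  trans (cong (weight b n +_) (measure-updateAt p r i))
        (+-Semigroup.x∙yz≈y∙xz (weight b n) (weight (lookup p i) 1) (measure p r))

sum-updateAt : (r : Vec ℕ m) (i : Fin m) → sum (updateAt r i suc) ≡ suc (sum r)
sum-updateAt (n ∷ r) zero = refl
sum-updateAt (n ∷ r) (suc i) = trans (cong (n +_) (sum-updateAt r i)) (+-suc n (sum r))

sum-regionSizes : (a b c : Subset k) → sum (regionSizes a b c) ≡ k
sum-regionSizes [] [] [] = refl
sum-regionSizes (x ∷ a) (y ∷ b) (z ∷ c) =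
  trans (sum-updateAt (regionSizes a b c) (region x y z)) (cong suc (sum-regionSizes a b c))

∣∷∣ : (b : Bool) (p : Subset k) → ∣ b ∷ p ∣ˢ ≡ weight b 1 + ∣ p ∣ˢ
∣∷∣ true p = refl
∣∷∣ false p = refl

∣⟦⟧∣≡measure : ∀ e (a b c : Subset k) → ∣ ⟦ e ⟧ a b c ∣ˢ ≡ measure (truthTable e) (regionSizes a b c)
∣⟦⟧∣≡measure e [] [] [] = trans (cong ∣_∣ˢ (⟦⟧-[] e)) (sym (measure-replicate (truthTable e)))
∣⟦⟧∣≡measure e (x ∷ a) (y ∷ b) (z ∷ c) = begin
  ∣ ⟦ e ⟧ (x ∷ a) (y ∷ b) (z ∷ c) ∣ˢ
    ≡⟨ cong ∣_∣ˢ (⟦⟧-∷ e) ⟩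
  ∣ ⟦ e ⟧ᵇ x y z ∷ ⟦ e ⟧ a b c ∣ˢ
    ≡⟨ ∣∷∣ (⟦ e ⟧ᵇ x y z) (⟦ e ⟧ a b c) ⟩
  weight (⟦ e ⟧ᵇ x y z) 1 + ∣ ⟦ e ⟧ a b c ∣ˢ
    ≡⟨ cong₂ _+_ (cong (λ h → weight h 1) (sym (lookup-truthTable e x y z))) (∣⟦⟧∣≡measure e a b c) ⟩
  weight (lookup (truthTable e) (region x y z)) 1 + measure (truthTable e) (regionSizes a b c)
    ≡⟨ measure-updateAt (truthTable e) (regionSizes a b c) (region x y z) ⟨
  measure (truthTable e) (regionSizes (x ∷ a) (y ∷ b) (z ∷ c)) ∎
  where open ≡-Reasoning

Forces-4-4-3 : (Combination → ℕ) → Set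
Forces-4-4-3 ν =
  ν 𝐚 ≡ 7 → ν 𝐛 ≡ 5 → ν 𝐜 ≡ 5 →
  ν (𝐚 ⊕ᶜ 𝐛) ≢ 2 → ν (𝐚 ⊕ᶜ 𝐜) ≢ 2 → ν (𝐛 ⊕ᶜ 𝐜) ≢ 2 → ν (𝐛 ⊕ᶜ 𝐜) ≢ 0 → ν (𝐚 ⊕ᶜ 𝐛 ⊕ᶜ 𝐜) ≢ 1 →
  ν (𝐚 ∩ᶜ 𝐛) ≡ 4 × ν (𝐚 ∩ᶜ 𝐜) ≡ 4 × ν (𝐛 ∩ᶜ 𝐜) ≡ 3

forces-4-4-3? : ∀ ν → Dec (Forces-4-4-3 ν)
forces-4-4-3? ν =
  ν 𝐚 ≟ 7 →-dec ν 𝐛 ≟ 5 →-dec ν 𝐜 ≟ 5 →-dec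
  ¬? (ν (𝐚 ⊕ᶜ 𝐛) ≟ 2) →-dec ¬? (ν (𝐚 ⊕ᶜ 𝐜) ≟ 2) →-dec ¬? (ν (𝐛 ⊕ᶜ 𝐜) ≟ 2) →-dec
  ¬? (ν (𝐛 ⊕ᶜ 𝐜) ≟ 0) →-dec ¬? (ν (𝐚 ⊕ᶜ 𝐛 ⊕ᶜ 𝐜) ≟ 1) →-dec
  (ν (𝐚 ∩ᶜ 𝐛) ≟ 4 ×-dec ν (𝐚 ∩ᶜ 𝐜) ≟ 4 ×-dec ν (𝐛 ∩ᶜ 𝐜) ≟ 3)

Forces-4-4-3-resp-≗ : ∀ {ν μ} → ν ≗ μ → Forces-4-4-3 ν → Forces-4-4-3 μ
Forces-4-4-3-resp-≗ {ν} {μ} ν≗μ forces h𝐚 h𝐛 h𝐜 h𝐚𝐛 h𝐚𝐜 h𝐛𝐜 h𝐛𝐜′ h𝐚𝐛𝐜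
  with forces (to h𝐚) (to h𝐛) (to h𝐜) (to≢ h𝐚𝐛) (to≢ h𝐚𝐜) (to≢ h𝐛𝐜) (to≢ h𝐛𝐜′) (to≢ h𝐚𝐛𝐜)
  where
  to : ∀ {e n} → μ e ≡ n → ν e ≡ n
  to = trans (ν≗μ _)
  to≢ : ∀ {e n} → μ e ≢ n → ν e ≢ n
  to≢ μe≢n = μe≢n ∘ trans (sym (ν≗μ _))
... | g𝐚𝐛 , g𝐚𝐜 , g𝐛𝐜 = from g𝐚𝐛 , from g𝐚𝐜 , from g𝐛𝐜
  where
  from : ∀ {e n} → ν e ≡ n → μ e ≡ n
  from = trans (sym (ν≗μ _))

vecsWithSum≤ : ℕ → (k : ℕ) → List (Vec ℕ k)
vecsWithSum≤ m zero = [] ∷ []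
vecsWithSum≤ m (suc k) = concatMap (λ r → map (_∷ r) (upTo (suc (m ∸ sum r)))) (vecsWithSum≤ m k)

∈-vecsWithSum≤ : (r : Vec ℕ k) → sum r ≤ m → r ∈ vecsWithSum≤ m k
∈-vecsWithSum≤ [] _ = here refl
∈-vecsWithSum≤ {m = m} (n ∷ r) n+Σr≤m =
  ∈-concatMap⁺ _ (Any.map (λ { refl → ∈-map⁺ (_∷ r) (∈-upTo⁺ (s≤s (m+n≤o⇒m≤o∸n n n+Σr≤m))) })
                        (∈-vecsWithSum≤ r (m+n≤o⇒n≤o n n+Σr≤m)))

-- Checked over all region sizes of total at most 8.  By hand: |𝐚 ∪ 𝐛| ≤ 8 gives
-- |𝐚 ∩ 𝐛| ≥ 4, and |𝐚 ⊕ 𝐛| = 12 − 2|𝐚 ∩ 𝐛| ≠ 2 excludes 5 (likewise for 𝐚, 𝐜).  Then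
-- 𝐜 ⊆ 𝐚 ∪ 𝐛, so |𝐚 ⊕ 𝐛 ⊕ 𝐜| = 2|𝐛 ∩ 𝐜| − 3 ≠ 1, and |𝐛 ⊕ 𝐜| = 10 − 2|𝐛 ∩ 𝐜| ∉ {0, 2}.
regions-force-4-4-3 : (r : Vec ℕ 8) → sum r ≤ 8 → Forces-4-4-3 (λ e → measure (truthTable e) r)
regions-force-4-4-3 r Σr≤8 = All.lookup all-cases (∈-vecsWithSum≤ r Σr≤8)
  where
  all-cases : All (λ r → Forces-4-4-3 (λ e → measure (truthTable e) r)) (vecsWithSum≤ 8 8)
  all-cases = toWitness {a? = all? (λ r → forces-4-4-3? (λ e → measure (truthTable e) r)) _} _

subsets-force-4-4-3 : (a b c : Subset k) → k ≤ 8 → Forces-4-4-3 (λ e → ∣ ⟦ e ⟧ a b c ∣ˢ)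
subsets-force-4-4-3 a b c k≤8 =
  Forces-4-4-3-resp-≗ (λ e → sym (∣⟦⟧∣≡measure e a b c))
    (regions-force-4-4-3 (regionSizes a b c) (subst (_≤ 8) (sym (sum-regionSizes a b c)) k≤8))

theorem6p1 : ∀ {n} (C B : List (Pt n)) →
    IsKCap 11 C → HasDim C 7 → IsBasis B C →
    (x₁ x₂ x₃ : Pt n) → x₁ ≢ x₂ → x₁ ≢ x₃ → x₂ ≢ x₃ →
    (∀ y → (y ∈ C × y ∉ B) ⇔ (y ≡ x₁ ⊎ y ≡ x₂ ⊎ y ≡ x₃)) →
    (T₁ T₂ T₃ : List (Pt n)) →
    IsRep B x₁ T₁ → IsRep B x₂ T₂ → IsRep B x₃ T₃ →
    length T₁ ≡ 7 → length T₂ ≡ 5 → length T₃ ≡ 5 →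
    ∣ T₁ ∩ T₂ ∣ ≡ 4 × ∣ T₁ ∩ T₃ ∣ ≡ 4 × ∣ T₂ ∩ T₃ ∣ ≡ 3
theorem6p1 C B (_ , |C|≡11 , cap) _ (B⊆C , (B! , _) , _) x₁ x₂ x₃ x₁≢x₂ x₁≢x₃ x₂≢x₃ C∖B≡D
  T₁ T₂ T₃ (T₁⊆B , σt₁) (T₂⊆B , σt₂) (T₃⊆B , σt₃) |T₁| |T₂| |T₃|
  with ⊆⇒select T₁⊆B | ⊆⇒select T₂⊆B | ⊆⇒select T₃⊆B
... | t₁ , refl | t₂ , refl | t₃ , refl =
  let ∣t₁∩t₂∣ , ∣t₁∩t₃∣ , ∣t₂∩t₃∣ =
        subsets-force-4-4-3 t₁ t₂ t₃ |B|≤8 (size t₁ |T₁|) (size t₂ |T₂|) (size t₃ |T₃|)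
          (∣p⊕q∣≢2 (refl ∷ refl ∷ x₃ ∷ʳ []) σt₁ σt₂)
          (∣p⊕q∣≢2 (refl ∷ x₂ ∷ʳ refl ∷ []) σt₁ σt₃)
          (∣p⊕q∣≢2 (x₁ ∷ʳ refl ∷ refl ∷ []) σt₂ σt₃)
          (∣p⊕q∣≢0 B x₂≢x₃ σt₂ σt₃)
          (∣p⊕q⊕r∣≢1 ⊆-refl σt₁ σt₂ σt₃)
  in trans (∣select∩select∣ B! t₁ t₂) ∣t₁∩t₂∣ , trans (∣select∩select∣ B! t₁ t₃) ∣t₁∩t₃∣ ,
     trans (∣select∩select∣ B! t₂ t₃) ∣t₂∩t₃∣
  where
  D = x₁ ∷ x₂ ∷ x₃ ∷ []
  D! : Unique D
  D! = (x₁≢x₂ ∷ x₁≢x₃ ∷ []) ∷ (x₂≢x₃ ∷ []) ∷ [] ∷ []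
  D⊆C∖B : ∀ {x} → x ∈ D → x ∈ C × x ∉ B
  D⊆C∖B (here refl) = Equivalence.from (C∖B≡D _) (inj₁ refl)
  D⊆C∖B (there (here refl)) = Equivalence.from (C∖B≡D _) (inj₂ (inj₁ refl))
  D⊆C∖B (there (there (here refl))) = Equivalence.from (C∖B≡D _) (inj₂ (inj₂ refl))
  open CapWithBasis cap B⊆C B! D! D⊆C∖B
  |B|≤8 : length B ≤ 8
  |B|≤8 = s≤s⁻¹ (s≤s⁻¹ (s≤s⁻¹ (subst (_ ≤_) |C|≡11 (length-++-basis≤ B⊆C B! D! D⊆C∖B))))
  size : ∀ t {s} → length (select B t) ≡ s → ∣ t ∣ˢ ≡ s
  size t = trans (sym (length-select B t))
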